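{- Fix $a$ and $q$ (generic, so that no denominator below vanishes). Let $(\alpha_n)_{n\ge0}$ be a sequence with $\alpha_0=1$ not depending on $k$, and for each $k$ let $(\beta_n(k))_{n\ge0}$ be a sequence such that, for every $k$, $(\alpha_n,\beta_n(k))$ is a WP-Bailey pair relative to $a,k$. Define $\alpha^*_0=1$, $\beta^*_0(k)=1$, and for $n\ge1$ \[ \alpha^*_n=(aq^n+q^{ -n})\alpha_n,\qquad \beta^*_n(k)=\frac{(1+aq^{2n})\beta_n(k)-(1-k)\left(1-\frac{k}{a}\right)\beta_{n-1}(kq)}{q^{n}}-a\,\frac{(k,k/a;q)_{n}}{(aq,q;q)_{n}}. \] Then for every $k$, $(\alpha^*_n,\beta^*_n(k))$ is a WP-Bailey pair relative to $a,k$.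
   Context: For $n\ge0$, $(x;q)_n=\prod_{i=0}^{n-1}(1-xq^i)$ and $(x_1,\dots,x_j;q)_n=(x_1;q)_n\cdots(x_j;q)_n$. A pair of sequences $(\bm\alpha_n,\bm\beta_n)_{n\ge0}$ is a WP-Bailey pair relative to $a,k$ (base $q$) if $\bm\alpha_0=1$ and for all $n\ge0$, $\bm\beta_n=\sum_{j=0}^{n}\frac{(k/a;q)_{n-j}(k;q)_{n+j}}{(q;q)_{n-j}(aq;q)_{n+j}}\bm\alpha_j$. -}

module Defs where

open import Level using (Level; _⊔_) renaming (suc to lsuc)
open import Data.Nat as ℕ using (ℕ; zero; suc; _∸_)
open import Data.Product using (_×_)
open import Relation.Nullary using (¬_)
open import Algebra.Bundles using (CommutativeRing)

-- A field: a commutative ring with 1 ≉ 0 and a (total) inverse operation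
-- that is a genuine inverse on every nonzero element (0⁻¹ is unspecified).
record Field (c ℓ : Level) : Set (lsuc (c ⊔ ℓ)) where
  field
    commutativeRing : CommutativeRing c ℓ
  open CommutativeRing commutativeRing public
  field
    _⁻¹      : Carrier → Carrier
    ⁻¹-cong  : ∀ {x y} → x ≈ y → x ⁻¹ ≈ y ⁻¹
    inverseʳ : ∀ x → ¬ (x ≈ 0#) → x * (x ⁻¹) ≈ 1#
    1≉0      : ¬ (1# ≈ 0#)

  infixl 7 _/_
  _/_ : Carrier → Carrier → Carrier
  x / y = x * (y ⁻¹)

module WP {c ℓ} (F : Field c ℓ) where
  open Field F hiding (zero)

  pow : Carrier → ℕ → Carrier
  pow x zero    = 1#
  pow x (suc n) = pow x n * x

  poch : Carrier → Carrier → ℕ → Carrier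
  poch x q zero    = 1#
  poch x q (suc n) = poch x q n * (1# - x * pow q n)

  sumTo : ℕ → (ℕ → Carrier) → Carrier
  sumTo zero    f = f zero
  sumTo (suc n) f = sumTo n f + f (suc n)

  IsWPBaileyPair : (a k q : Carrier) → (ℕ → Carrier) → (ℕ → Carrier) → Set ℓ
  IsWPBaileyPair a k q α β =
    (α zero ≈ 1#) ×
    (∀ n → β n ≈ sumTo n (λ j →
        ((poch (k / a) q (n ∸ j) * poch k q (n ℕ.+ j))
          / (poch q q (n ∸ j) * poch (a * q) q (n ℕ.+ j))) * α j))

  αStar : (a q : Carrier) → (ℕ → Carrier) → ℕ → Carrier
  αStar a q α zero    = 1#
  αStar a q α (suc n) = (a * pow q (suc n) + pow q (suc n) ⁻¹) * α (suc n)

  βStar : (a q : Carrier) → (Carrier → ℕ → Carrier) → Carrier → ℕ → Carrier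
  βStar a q β k zero    = 1#
  βStar a q β k (suc n) =
    ((1# + a * pow q (2 ℕ.* suc n)) * β k (suc n)
       - (1# - k) * (1# - k / a) * β (k * q) n) / pow q (suc n)
    - a * ((poch k q (suc n) * poch (k / a) q (suc n))
             / (poch (a * q) q (suc n) * poch q q (suc n)))

{-# OPTIONS --safe #-}
module Submission where

-- Write c_k(n, j) for the coefficient of α_j in β_n(k).  Peeling the first factor off each
-- Pochhammer symbol gives (1 - k)(1 - k/a) c_kq(n - 1, j) = c_k(n, j) (1 - q^(n-j)) (1 - a q^(n+j)),
-- which vanishes at j = n; so the two Bailey sums in β*_n(k) merge into one whose j-th term carries
-- 1 + a q^(2n) - (1 - q^(n-j)) (1 - a q^(n+j)) = q^n (a q^j + q^(-j)).  The correction term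
-- -a c_k(n, 0) turns the j = 0 term (1 + a) α_0 into α*_0 = 1.

open import Defs
open import Algebra.Bundles using (CommutativeRing)
open import Algebra.Solver.Ring.AlmostCommutativeRing using (fromCommutativeRing; _-Raw-AlmostCommutative⟶_)
import Algebra.Solver.Ring as Solver
open import Data.Integer.Base as ℤ using (ℤ; +_; -[1+_]; _◃_; _⊖_)
open import Data.Integer.Properties as ℤ using ()
open import Data.Maybe.Base using (map)
open import Data.Nat.Base as ℕ using (ℕ; zero; suc)
open import Data.Nat.Properties as ℕ using ()
open import Data.Product.Base using (_,_; proj₁; proj₂)
open import Data.Sign.Base using (Sign)
open import Relation.Binary.PropositionalEquality as ≡ using ()
open import Relation.Nullary using (¬_)
open import Relation.Nullary.Decidable using (dec⇒maybe)

-- The solver compares normal forms by refl, so its coefficients must compute; hence ℤ rather than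
-- the carrier itself.
module IntegerCoefficientSolver {c ℓ} (R : CommutativeRing c ℓ) where
  open CommutativeRing R
  open import Algebra.Properties.Semiring.Mult.TCOptimised semiring using (_×_; 1+×; ×-homo-+; ×1-homo-*)
  open import Algebra.Properties.Ring ring using (-0#≈0#; -‿involutive; -‿distribˡ-*; -‿distribʳ-*; -‿+-comm)
  open import Relation.Binary.Reasoning.Setoid setoid

  ⟦_⟧ℤ : ℤ → Carrier
  ⟦ + n ⟧ℤ      = n × 1#
  ⟦ -[1+ n ] ⟧ℤ = - (suc n × 1#)

  ⟦+◃⟧ : ∀ n → ⟦ Sign.+ ◃ n ⟧ℤ ≈ n × 1#
  ⟦+◃⟧ zero    = refl
  ⟦+◃⟧ (suc n) = refl

  ⟦-◃⟧ : ∀ n → ⟦ Sign.- ◃ n ⟧ℤ ≈ - (n × 1#)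
  ⟦-◃⟧ zero    = sym -0#≈0#
  ⟦-◃⟧ (suc n) = refl

  [1+x]-[1+y]≈x-y : ∀ x y → (1# + x) - (1# + y) ≈ x - y
  [1+x]-[1+y]≈x-y x y = begin
    (1# + x) - (1# + y)        ≈⟨ +-cong (+-comm x 1#) (-‿+-comm 1# y) ⟨
    (x + 1#) + (- 1# + - y)    ≈⟨ +-assoc x 1# _ ⟩
    x + (1# + (- 1# + - y))    ≈⟨ +-congˡ (+-assoc 1# (- 1#) (- y)) ⟨
    x + ((1# - 1#) + - y)      ≈⟨ +-congˡ (+-congʳ (-‿inverseʳ 1#)) ⟩
    x + (0# + - y)             ≈⟨ +-congˡ (+-identityˡ (- y)) ⟩
    x - y                      ∎

  ⟦⊖⟧ : ∀ m n → ⟦ m ⊖ n ⟧ℤ ≈ m × 1# - n × 1#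
  ⟦⊖⟧ zero    zero    = sym (trans (+-identityˡ _) -0#≈0#)
  ⟦⊖⟧ (suc m) zero    = sym (trans (+-congˡ -0#≈0#) (+-identityʳ _))
  ⟦⊖⟧ zero    (suc n) = sym (+-identityˡ _)
  ⟦⊖⟧ (suc m) (suc n) = begin
    ⟦ suc m ⊖ suc n ⟧ℤ             ≡⟨ ≡.cong ⟦_⟧ℤ (ℤ.[1+m]⊖[1+n]≡m⊖n m n) ⟩
    ⟦ m ⊖ n ⟧ℤ                     ≈⟨ ⟦⊖⟧ m n ⟩
    m × 1# - n × 1#                ≈⟨ [1+x]-[1+y]≈x-y (m × 1#) (n × 1#) ⟨
    (1# + m × 1#) - (1# + n × 1#)  ≈⟨ +-cong (1+× m 1#) (-‿cong (1+× n 1#)) ⟨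
    suc m × 1# - suc n × 1#        ∎

  ⟦+⟧ : ∀ i j → ⟦ i ℤ.+ j ⟧ℤ ≈ ⟦ i ⟧ℤ + ⟦ j ⟧ℤ
  ⟦+⟧ (+ m)    (+ n)    = ×-homo-+ 1# m n
  ⟦+⟧ (+ m)    -[1+ n ] = ⟦⊖⟧ m (suc n)
  ⟦+⟧ -[1+ m ] (+ n)    = trans (⟦⊖⟧ n (suc m)) (+-comm _ _)
  ⟦+⟧ -[1+ m ] -[1+ n ] = begin
    - (suc (suc (m ℕ.+ n)) × 1#)     ≡⟨ ≡.cong (λ k → - (k × 1#)) (ℕ.+-suc (suc m) n) ⟨
    - ((suc m ℕ.+ suc n) × 1#)       ≈⟨ -‿cong (×-homo-+ 1# (suc m) (suc n)) ⟩
    - (suc m × 1# + suc n × 1#)      ≈⟨ -‿+-comm _ _ ⟨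
    - (suc m × 1#) + - (suc n × 1#)  ∎

  ⟦*⟧ : ∀ i j → ⟦ i ℤ.* j ⟧ℤ ≈ ⟦ i ⟧ℤ * ⟦ j ⟧ℤ
  ⟦*⟧ (+ m)    (+ n)    = trans (⟦+◃⟧ (m ℕ.* n)) (×1-homo-* m n)
  ⟦*⟧ (+ m)    -[1+ n ] = trans (⟦-◃⟧ (m ℕ.* suc n)) (trans (-‿cong (×1-homo-* m (suc n))) (-‿distribʳ-* _ _))
  ⟦*⟧ -[1+ m ] (+ n)    = trans (⟦-◃⟧ (suc m ℕ.* n)) (trans (-‿cong (×1-homo-* (suc m) n)) (-‿distribˡ-* _ _))
  ⟦*⟧ -[1+ m ] -[1+ n ] = begin
    (suc m ℕ.* suc n) × 1#           ≈⟨ ×1-homo-* (suc m) (suc n) ⟩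
    suc m × 1# * suc n × 1#          ≈⟨ -‿involutive _ ⟨
    - - (suc m × 1# * suc n × 1#)    ≈⟨ -‿cong (-‿distribˡ-* _ _) ⟩
    - (- (suc m × 1#) * suc n × 1#)  ≈⟨ -‿distribʳ-* _ _ ⟩
    - (suc m × 1#) * - (suc n × 1#)  ∎

  ⟦-⟧ : ∀ i → ⟦ ℤ.- i ⟧ℤ ≈ - ⟦ i ⟧ℤ
  ⟦-⟧ (+ zero)  = sym -0#≈0#
  ⟦-⟧ (+ suc n) = refl
  ⟦-⟧ -[1+ n ]  = sym (-‿involutive _)

  ℤ-homomorphism : ℤ.+-*-rawRing -Raw-AlmostCommutative⟶ fromCommutativeRing R
  ℤ-homomorphism = record
    { ⟦_⟧ = ⟦_⟧ℤ ; +-homo = ⟦+⟧ ; *-homo = ⟦*⟧ ; -‿homo = ⟦-⟧ ; 0-homo = refl ; 1-homo = refl }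

  open Solver ℤ.+-*-rawRing (fromCommutativeRing R) ℤ-homomorphism
    (λ i j → map (λ i≡j → reflexive (≡.cong ⟦_⟧ℤ i≡j)) (dec⇒maybe (i ℤ.≟ j)))
    public using (solve; _:=_; _:+_; _:*_; _:-_; con)

module _ {r ℓ} (F : Field r ℓ) where
  open Field F hiding (zero)
  open WP F
  open IntegerCoefficientSolver commutativeRing
  open import Relation.Binary.Reasoning.Setoid setoid

  ≉0-resp : ∀ {x y} → x ≈ y → ¬ x ≈ 0# → ¬ y ≈ 0#
  ≉0-resp x≈y x≉0 y≈0 = x≉0 (trans x≈y y≈0)

  x*y*y⁻¹≈x : ∀ x {y} → ¬ y ≈ 0# → x * y * y ⁻¹ ≈ x
  x*y*y⁻¹≈x x {y} y≉0 = trans (*-assoc x y (y ⁻¹)) (trans (*-congˡ (inverseʳ y y≉0)) (*-identityʳ x))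

  x*y≉0 : ∀ {x y} → ¬ x ≈ 0# → ¬ y ≈ 0# → ¬ x * y ≈ 0#
  x*y≉0 {x} {y} x≉0 y≉0 xy≈0 = x≉0 (begin
    x             ≈⟨ x*y*y⁻¹≈x x y≉0 ⟨
    x * y * y ⁻¹  ≈⟨ *-congʳ xy≈0 ⟩
    0# * y ⁻¹     ≈⟨ zeroˡ _ ⟩
    0#            ∎)

  x*y≉0⇒y≉0 : ∀ {x y} → ¬ x * y ≈ 0# → ¬ y ≈ 0#
  x*y≉0⇒y≉0 {x} xy≉0 y≈0 = xy≉0 (trans (*-congˡ y≈0) (zeroʳ x))

  ⁻¹-unique : ∀ {x y} → ¬ x ≈ 0# → x * y ≈ 1# → y ≈ x ⁻¹
  ⁻¹-unique {x} {y} x≉0 xy≈1 = begin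
    y             ≈⟨ x*y*y⁻¹≈x y x≉0 ⟨
    y * x * x ⁻¹  ≈⟨ *-congʳ (trans (*-comm y x) xy≈1) ⟩
    1# * x ⁻¹     ≈⟨ *-identityˡ _ ⟩
    x ⁻¹          ∎

  1⁻¹≈1 : 1# ⁻¹ ≈ 1#
  1⁻¹≈1 = sym (⁻¹-unique 1≉0 (*-identityˡ 1#))

  x/[y*z]*z≈x/y : ∀ x {y z} → ¬ y ≈ 0# → ¬ z ≈ 0# → x / (y * z) * z ≈ x / y
  x/[y*z]*z≈x/y x {y} {z} y≉0 z≉0 = trans (*-assoc x _ z) (*-congˡ (⁻¹-unique y≉0 y*[[y*z]⁻¹*z]≈1))
    where
    y*[[y*z]⁻¹*z]≈1 : y * ((y * z) ⁻¹ * z) ≈ 1#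
    y*[[y*z]⁻¹*z]≈1 = begin
      y * ((y * z) ⁻¹ * z)  ≈⟨ solve 3 (λ y z w → y :* (w :* z) := y :* z :* w) refl y z ((y * z) ⁻¹) ⟩
      y * z * (y * z) ⁻¹    ≈⟨ inverseʳ _ (x*y≉0 y≉0 z≉0) ⟩
      1#                    ∎

  pow-+ : ∀ x m n → pow x (m ℕ.+ n) ≈ pow x m * pow x n
  pow-+ x zero    n = sym (*-identityˡ _)
  pow-+ x (suc m) n = begin
    pow x (m ℕ.+ n) * x    ≈⟨ *-congʳ (pow-+ x m n) ⟩
    pow x m * pow x n * x  ≈⟨ solve 3 (λ u v x → u :* v :* x := u :* x :* v) refl (pow x m) (pow x n) x ⟩
    pow x m * x * pow x n  ∎

  pow-∸ : ∀ x {m n} → n ℕ.≤ m → pow x m ≈ pow x (m ℕ.∸ n) * pow x n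
  pow-∸ x {m} {n} n≤m = begin
    pow x m                      ≡⟨ ≡.cong (pow x) (ℕ.m∸n+n≡m n≤m) ⟨
    pow x (m ℕ.∸ n ℕ.+ n)        ≈⟨ pow-+ x (m ℕ.∸ n) n ⟩
    pow x (m ℕ.∸ n) * pow x n    ∎

  pow≉0 : ∀ {x} → ¬ x ≈ 0# → ∀ n → ¬ pow x n ≈ 0#
  pow≉0 x≉0 zero    = 1≉0
  pow≉0 x≉0 (suc n) = x*y≉0 (pow≉0 x≉0 n) x≉0

  poch-congˡ : ∀ {x y} q n → x ≈ y → poch x q n ≈ poch y q n
  poch-congˡ q zero    x≈y = refl
  poch-congˡ q (suc n) x≈y = *-cong (poch-congˡ q n x≈y) (+-congˡ (-‿cong (*-congʳ x≈y)))

  poch-suc : ∀ x q n → poch x q (suc n) ≈ (1# - x) * poch (x * q) q n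
  poch-suc x q zero = solve 1 (λ x → con (+ 1) :* (con (+ 1) :- x :* con (+ 1)) := (con (+ 1) :- x) :* con (+ 1)) refl x
  poch-suc x q (suc n) = begin
    poch x q (suc n) * (1# - x * (pow q n * q))              ≈⟨ *-congʳ (poch-suc x q n) ⟩
    (1# - x) * poch (x * q) q n * (1# - x * (pow q n * q))   ≈⟨ solve 4 (λ x q p r → (con (+ 1) :- x) :* p :* (con (+ 1) :- x :* (r :* q))
                                                                      := (con (+ 1) :- x) :* (p :* (con (+ 1) :- x :* q :* r)))
                                                                  refl x q (poch (x * q) q n) (pow q n) ⟩
    (1# - x) * (poch (x * q) q n * (1# - x * q * pow q n))   ∎

  sumTo-cong : ∀ n {f g : ℕ → Carrier} → (∀ j → j ℕ.≤ n → f j ≈ g j) → sumTo n f ≈ sumTo n g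
  sumTo-cong zero    f≈g = f≈g 0 ℕ.z≤n
  sumTo-cong (suc n) f≈g = +-cong (sumTo-cong n (λ j j≤n → f≈g j (ℕ.m≤n⇒m≤1+n j≤n))) (f≈g (suc n) ℕ.≤-refl)

  sumTo-*ˡ : ∀ n x (f : ℕ → Carrier) → x * sumTo n f ≈ sumTo n (λ j → x * f j)
  sumTo-*ˡ zero    x f = refl
  sumTo-*ˡ (suc n) x f = trans (distribˡ x _ _) (+-congʳ (sumTo-*ˡ n x f))

  sumTo-*ʳ : ∀ n x (f : ℕ → Carrier) → sumTo n f * x ≈ sumTo n (λ j → f j * x)
  sumTo-*ʳ zero    x f = refl
  sumTo-*ʳ (suc n) x f = trans (distribʳ x _ _) (+-congʳ (sumTo-*ʳ n x f))

  sumTo-- : ∀ n (f g : ℕ → Carrier) → sumTo n (λ j → f j - g j) ≈ sumTo n f - sumTo n g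
  sumTo-- zero    f g = refl
  sumTo-- (suc n) f g = trans (+-congʳ (sumTo-- n f g))
    (solve 4 (λ a b c d → (a :- b) :+ (c :- d) := (a :+ c) :- (b :+ d)) refl (sumTo n f) (sumTo n g) (f (suc n)) (g (suc n)))

  sumTo-head : ∀ n {f g : ℕ → Carrier} → (∀ j → f (suc j) ≈ g (suc j)) → sumTo n f ≈ sumTo n g + (f 0 - g 0)
  sumTo-head zero    {f} {g} f≈g = solve 2 (λ x y → x := y :+ (x :- y)) refl (f 0) (g 0)
  sumTo-head (suc n) {f} {g} f≈g = begin
    sumTo n f + f (suc n)                ≈⟨ +-cong (sumTo-head n f≈g) (f≈g n) ⟩
    sumTo n g + (f 0 - g 0) + g (suc n)  ≈⟨ solve 3 (λ x y z → x :+ y :+ z := x :+ z :+ y) refl (sumTo n g) (f 0 - g 0) (g (suc n)) ⟩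
    sumTo n g + g (suc n) + (f 0 - g 0)  ∎

  module Coefficients (a q : Carrier) (q≉0 : ¬ q ≈ 0#)
                      (poch-q≉0 : ∀ m → ¬ poch q q m ≈ 0#) (poch-aq≉0 : ∀ m → ¬ poch (a * q) q m ≈ 0#) where

    coeff : Carrier → ℕ → ℕ → Carrier
    coeff k d e = (poch (k / a) q d * poch k q e) / (poch q q d * poch (a * q) q e)

    coeff-suc : ∀ k d e → (1# - k) * (1# - k / a) * coeff (k * q) d e
                          ≈ coeff k (suc d) (suc e) * ((1# - pow q (suc d)) * (1# - a * pow q (suc e)))
    coeff-suc k d e = sym (begin
      coeff k (suc d) (suc e) * P  ≈⟨ *-congʳ (*-cong numerator (⁻¹-cong denominator)) ⟩
      K * N / (D * P) * P          ≈⟨ x/[y*z]*z≈x/y (K * N) (x*y≉0 (poch-q≉0 d) (poch-aq≉0 e)) P≉0 ⟩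
      K * N / D                    ≈⟨ *-assoc K N (D ⁻¹) ⟩
      K * coeff (k * q) d e        ∎)
      where
      K N D P : Carrier
      K = (1# - k) * (1# - k / a)
      N = poch ((k * q) / a) q d * poch (k * q) q e
      D = poch q q d * poch (a * q) q e
      P = (1# - pow q (suc d)) * (1# - a * pow q (suc e))

      numerator : poch (k / a) q (suc d) * poch k q (suc e) ≈ K * N
      numerator = begin
        poch (k / a) q (suc d) * poch k q (suc e)
          ≈⟨ *-cong (poch-suc (k / a) q d) (poch-suc k q e) ⟩
        (1# - k / a) * poch (k / a * q) q d * ((1# - k) * poch (k * q) q e)
          ≈⟨ *-congʳ (*-congˡ (poch-congˡ q d (solve 3 (λ k a⁻¹ q → k :* a⁻¹ :* q := k :* q :* a⁻¹) refl k (a ⁻¹) q))) ⟩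
        (1# - k / a) * poch ((k * q) / a) q d * ((1# - k) * poch (k * q) q e)
          ≈⟨ solve 4 (λ x y z w → x :* y :* (z :* w) := z :* x :* (y :* w)) refl (1# - k / a) (poch ((k * q) / a) q d) (1# - k) (poch (k * q) q e) ⟩
        K * N ∎

      denominator : poch q q (suc d) * poch (a * q) q (suc e) ≈ D * P
      denominator = solve 6 (λ x y q a u v → x :* (con (+ 1) :- q :* u) :* (y :* (con (+ 1) :- a :* q :* v))
                                           := x :* y :* ((con (+ 1) :- u :* q) :* (con (+ 1) :- a :* (v :* q))))
                      refl (poch q q d) (poch (a * q) q e) q a (pow q d) (pow q e)

      P≉0 : ¬ P ≈ 0#
      P≉0 = x*y≉0⇒y≉0 (≉0-resp denominator (x*y≉0 (poch-q≉0 (suc d)) (poch-aq≉0 (suc e))))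

    weight : ∀ {n j} → j ℕ.≤ n →
             (1# + a * pow q (2 ℕ.* n) - (1# - pow q (n ℕ.∸ j)) * (1# - a * pow q (n ℕ.+ j))) * pow q n ⁻¹
             ≈ a * pow q j + pow q j ⁻¹
    weight {n} {j} j≤n = begin
      (1# + a * pow q (2 ℕ.* n) - (1# - u) * (1# - a * pow q (n ℕ.+ j))) * pow q n ⁻¹  ≈⟨ *-cong numerator (⁻¹-cong qⁿ≈uv) ⟩
      u * v * W * (u * v) ⁻¹                                                       ≈⟨ *-congʳ (*-comm _ W) ⟩
      W * (u * v) * (u * v) ⁻¹                                                     ≈⟨ x*y*y⁻¹≈x W (x*y≉0 (pow≉0 q≉0 (n ℕ.∸ j)) v≉0) ⟩
      W                                                                            ∎
      where
      u v W : Carrier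
      u = pow q (n ℕ.∸ j)
      v = pow q j
      W = a * v + v ⁻¹

      v≉0 : ¬ v ≈ 0#
      v≉0 = pow≉0 q≉0 j

      qⁿ≈uv : pow q n ≈ u * v
      qⁿ≈uv = pow-∸ q j≤n

      q²ⁿ≈uvuv : pow q (2 ℕ.* n) ≈ u * v * (u * v)
      q²ⁿ≈uvuv = begin
        pow q (n ℕ.+ (n ℕ.+ 0))  ≡⟨ ≡.cong (λ m → pow q (n ℕ.+ m)) (ℕ.+-identityʳ n) ⟩
        pow q (n ℕ.+ n)          ≈⟨ pow-+ q n n ⟩
        pow q n * pow q n        ≈⟨ *-cong qⁿ≈uv qⁿ≈uv ⟩
        u * v * (u * v)          ∎

      numerator : 1# + a * pow q (2 ℕ.* n) - (1# - u) * (1# - a * pow q (n ℕ.+ j)) ≈ u * v * W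
      numerator = begin
        1# + a * pow q (2 ℕ.* n) - (1# - u) * (1# - a * pow q (n ℕ.+ j))
          ≈⟨ +-cong (+-congˡ (*-congˡ q²ⁿ≈uvuv)) (-‿cong (*-congˡ (+-congˡ (-‿cong (*-congˡ (trans (pow-+ q n j) (*-congʳ qⁿ≈uv))))))) ⟩
        1# + a * (u * v * (u * v)) - (1# - u) * (1# - a * (u * v * v))
          ≈⟨ solve 3 (λ a u v → con (+ 1) :+ a :* (u :* v :* (u :* v)) :- (con (+ 1) :- u) :* (con (+ 1) :- a :* (u :* v :* v))
                                := a :* u :* v :* v :+ u :* con (+ 1)) refl a u v ⟩
        a * u * v * v + u * 1#
          ≈⟨ +-congˡ (*-congˡ (inverseʳ v v≉0)) ⟨
        a * u * v * v + u * (v * v ⁻¹)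
          ≈⟨ solve 4 (λ a u v v⁻¹ → a :* u :* v :* v :+ u :* (v :* v⁻¹) := u :* v :* (a :* v :+ v⁻¹)) refl a u v (v ⁻¹) ⟩
        u * v * W ∎

  module Star (a q : Carrier) (q≉0 : ¬ q ≈ 0#)
              (poch-q≉0 : ∀ m → ¬ poch q q m ≈ 0#) (poch-aq≉0 : ∀ m → ¬ poch (a * q) q m ≈ 0#)
              (α : ℕ → Carrier) (β : Carrier → ℕ → Carrier)
              (pair : ∀ k → IsWPBaileyPair a k q α (β k)) (k : Carrier) where
    open Coefficients a q q≉0 poch-q≉0 poch-aq≉0

    c : ℕ → ℕ → Carrier
    c n j = coeff k (n ℕ.∸ j) (n ℕ.+ j)

    P : ℕ → ℕ → Carrier
    P n j = (1# - pow q (n ℕ.∸ j)) * (1# - a * pow q (n ℕ.+ j))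

    K : Carrier
    K = (1# - k) * (1# - k / a)

    coeff-shift : ∀ {m j} → j ℕ.≤ m → K * coeff (k * q) (m ℕ.∸ j) (m ℕ.+ j) ≈ c (suc m) j * P (suc m) j
    coeff-shift {m} {j} j≤m rewrite ℕ.+-∸-assoc 1 j≤m = coeff-suc k (m ℕ.∸ j) (m ℕ.+ j)

    P-diagonal : ∀ n → P n n ≈ 0#
    P-diagonal n rewrite ℕ.n∸n≡0 n = trans (*-congʳ (-‿inverseʳ 1#)) (zeroˡ _)

    shifted-pair : ∀ m → K * β (k * q) m ≈ sumTo (suc m) (λ j → c (suc m) j * P (suc m) j * α j)
    shifted-pair m = begin
      K * β (k * q) m
        ≈⟨ *-congˡ (proj₂ (pair (k * q)) m) ⟩
      K * sumTo m (λ j → coeff (k * q) (m ℕ.∸ j) (m ℕ.+ j) * α j)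
        ≈⟨ sumTo-*ˡ m K _ ⟩
      sumTo m (λ j → K * (coeff (k * q) (m ℕ.∸ j) (m ℕ.+ j) * α j))
        ≈⟨ sumTo-cong m (λ j j≤m → trans (sym (*-assoc _ _ _)) (*-congʳ (coeff-shift j≤m))) ⟩
      sumTo m f
        ≈⟨ +-identityʳ _ ⟨
      sumTo m f + 0#
        ≈⟨ +-congˡ (trans (*-congʳ (trans (*-congˡ (P-diagonal n)) (zeroʳ _))) (zeroˡ _)) ⟨
      sumTo n f ∎
      where
      n : ℕ
      n = suc m

      f : ℕ → Carrier
      f j = c n j * P n j * α j

    c-zero : ∀ n → c n 0 ≈ (poch k q n * poch (k / a) q n) / (poch (a * q) q n * poch q q n)
    c-zero n rewrite ℕ.+-identityʳ n = *-cong (*-comm _ _) (⁻¹-cong (*-comm _ _))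

    βStar-suc : ∀ m → βStar a q β k (suc m) ≈ sumTo (suc m) (λ j → c (suc m) j * αStar a q α j)
    βStar-suc m = begin
      (Y * β k n - K * β (k * q) m) * qⁿ⁻¹ - a * E
        ≈⟨ +-congʳ (*-congʳ (+-cong (*-congˡ (proj₂ (pair k) n)) (-‿cong (shifted-pair m)))) ⟩
      (Y * sumTo n (λ j → c n j * α j) - sumTo n (λ j → c n j * P n j * α j)) * qⁿ⁻¹ - a * E
        ≈⟨ +-congʳ (*-congʳ (+-congʳ (sumTo-*ˡ n Y _))) ⟩
      (sumTo n (λ j → Y * (c n j * α j)) - sumTo n (λ j → c n j * P n j * α j)) * qⁿ⁻¹ - a * E
        ≈⟨ +-congʳ (*-congʳ (sumTo-- n _ _)) ⟨
      sumTo n (λ j → Y * (c n j * α j) - c n j * P n j * α j) * qⁿ⁻¹ - a * E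
        ≈⟨ +-congʳ (sumTo-*ʳ n qⁿ⁻¹ _) ⟩
      sumTo n (λ j → (Y * (c n j * α j) - c n j * P n j * α j) * qⁿ⁻¹) - a * E
        ≈⟨ +-congʳ (sumTo-cong n summand) ⟩
      sumTo n (λ j → c n j * ((a * pow q j + pow q j ⁻¹) * α j)) - a * E
        ≈⟨ +-congʳ (sumTo-head n (λ _ → refl)) ⟩
      sumTo n (λ j → c n j * αStar a q α j) + (c n 0 * ((a * 1# + 1# ⁻¹) * α 0) - c n 0 * 1#) - a * E
        ≈⟨ +-congʳ (+-congˡ head) ⟩
      sumTo n (λ j → c n j * αStar a q α j) + a * E - a * E
        ≈⟨ solve 2 (λ s x → s :+ x :- x := s) refl _ (a * E) ⟩
      sumTo n (λ j → c n j * αStar a q α j) ∎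
      where
      n : ℕ
      n = suc m

      Y qⁿ⁻¹ E : Carrier
      Y = 1# + a * pow q (2 ℕ.* n)
      qⁿ⁻¹ = pow q n ⁻¹
      E = (poch k q n * poch (k / a) q n) / (poch (a * q) q n * poch q q n)

      summand : ∀ j → j ℕ.≤ n → (Y * (c n j * α j) - c n j * P n j * α j) * qⁿ⁻¹ ≈ c n j * ((a * pow q j + pow q j ⁻¹) * α j)
      summand j j≤n = begin
        (Y * (c n j * α j) - c n j * P n j * α j) * qⁿ⁻¹  ≈⟨ solve 5 (λ y x z p i → (y :* (x :* z) :- x :* p :* z) :* i := x :* ((y :- p) :* i :* z)) refl Y (c n j) (α j) (P n j) qⁿ⁻¹ ⟩
        c n j * ((Y - P n j) * qⁿ⁻¹ * α j)                ≈⟨ *-congˡ (*-congʳ (weight j≤n)) ⟩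
        c n j * ((a * pow q j + pow q j ⁻¹) * α j)        ∎

      head : c n 0 * ((a * 1# + 1# ⁻¹) * α 0) - c n 0 * 1# ≈ a * E
      head = begin
        c n 0 * ((a * 1# + 1# ⁻¹) * α 0) - c n 0 * 1#  ≈⟨ +-congʳ (*-congˡ (*-cong (+-congˡ 1⁻¹≈1) (proj₁ (pair k)))) ⟩
        c n 0 * ((a * 1# + 1#) * 1#) - c n 0 * 1#      ≈⟨ solve 2 (λ x a → x :* ((a :* con (+ 1) :+ con (+ 1)) :* con (+ 1)) :- x :* con (+ 1) := a :* x) refl (c n 0) a ⟩
        a * c n 0                                      ≈⟨ *-congˡ (c-zero n) ⟩
        a * E                                          ∎

    isWPBaileyPair : IsWPBaileyPair a k q (αStar a q α) (βStar a q β k)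
    isWPBaileyPair = refl , λ where
      zero    → sym (trans (*-identityʳ _) (inverseʳ _ (x*y≉0 1≉0 1≉0)))
      (suc m) → βStar-suc m

mainTheorem1 : ∀ {c ℓ} (F : Field c ℓ) →
    let open Field F
        open WP F
    in (a q : Carrier) →
       ¬ (a ≈ 0#) → ¬ (q ≈ 0#) →
       (∀ m → ¬ (poch q q m ≈ 0#)) →
       (∀ m → ¬ (poch (a * q) q m ≈ 0#)) →
       (α : ℕ → Carrier) → (β : Carrier → ℕ → Carrier) →
       (∀ k → IsWPBaileyPair a k q α (β k)) →
       ∀ k → IsWPBaileyPair a k q (αStar a q α) (βStar a q β k)
mainTheorem1 F a q _ q≉0 poch-q≉0 poch-aq≉0 α β pair k =
  Star.isWPBaileyPair F a q q≉0 poch-q≉0 poch-aq≉0 α β pair k
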